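{- Let $G=(V,E)$ be an Eulerian directed multigraph with $V=[n]$ and $|E|=m\ge 1$, given with fixed orderings of the incoming and outgoing edges at each vertex. Run Algorithm \textsc{Space-Efficient-Hierholzer} (described in the context) on $G$, and let $u_0u_1, u_1u_2, \dots, u_{m-1}u_m$ be the sequence of edges it writes, in order. Then this sequence is an Eulerian cycle of $G$: $u_m=u_0$, and for every ordered pair $(x,y)$ of vertices, the number of indices $j$ with $(u_j,u_{j+1})=(x,y)$ equals the number of edges from $x$ to $y$ in $G$.
   Context: $G=(V,E)$ is a finite directed multigraph (loops and parallel edges allowed), $V=[n]=\{1,\dots,n\}$, $E$ a multiset of $m$ directed edges; $uv$ denotes an edge from $u$ to $v$. $d^+(v)$ and $d^-(v)$ are the out- and in-degree of $v$. $G$ is Eulerian: it is strongly connected (for every ordered pair of vertices there is a directed path between them) and $d^+(v)=d^-(v)$ for all $v$. An Eulerian cycle is a closed trail using every edge exactly once. For each vertex $v$ the outgoing edges and the incoming edges are each listed in an arbitrary fixed order; $\Gamma^+(v,i)$ is the head of the $i$-th outgoing edge of $v$ ($1\le i\le d^+(v)$) and $\Gamma^-(v,i)$ is the tail of the $i$-th incoming edge of $v$ ($1\le i\le d^-(v)$). Algorithm \textsc{Space-Efficient-Hierholzer}: initialise integer arrays $\texttt{next}[1..n]$, $\texttt{visited}[1..n]$, $\texttt{skipped}[1..n]$, $B[1..n]$ to all zeros and $c\gets 0$. Pick an arbitrary $v_0\in[n]$, set $u\gets v_0$ and $\texttt{visited}[u]\gets 1$. While $c<m$: set $\texttt{next}[u]\gets\texttt{next}[u]+1$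 and $i\gets\texttt{next}[u]$. If $i\le d^-(u)$: let $v\gets\Gamma^-(u,i)$; if $\texttt{visited}[v]=0$ then (if $v\ne v_0$ set $B[v]\gets u$) and set $\texttt{visited}[v]\gets 1$; then set $u\gets v$. Otherwise ($i>d^-(u)$): set $i\gets \texttt{next}[u]-d^-(u)$; if $\Gamma^+(u,i)=B[u]$ and $\texttt{skipped}[u]=0$, then set $\texttt{skipped}[u]\gets 1$, $\texttt{next}[u]\gets\texttt{next}[u]+1$, $i\gets i+1$ (the test $\Gamma^+(u,i)=B[u]$ is taken to be false if $i>d^+(u)$). Then if $i>d^+(u)$ let $v\gets B[u]$, else let $v\gets \Gamma^+(u,i)$; write the edge $uv$ to the output, set $c\gets c+1$ and $u\gets v$. -}

module Defs where

open import Data.Nat using (ℕ; zero; suc; _+_; _∸_; _≤_; _≤?_; _<_; _<?_)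
open import Data.Nat.ListAction using (sum)
open import Data.Fin using (Fin; _≟_)
open import Data.Bool using (Bool; true; false; if_then_else_; not; _∧_)
open import Data.Maybe using (Maybe; just; nothing)
open import Data.List using (List; []; _∷_; _++_; [_]; length; map; allFin)
open import Data.Product using (_×_; _,_; proj₁; proj₂; ∃-syntax)
open import Relation.Nullary using (yes; no; does; Dec)
open import Relation.Binary.PropositionalEquality using (_≡_)
open import Data.List.Membership.Propositional using (_∈_)

-- A directed multigraph on vertex set Fin n (vertex k ↔ k+1 of the paper)
-- given by its ordered out-lists and in-lists:
--   out v = [Γ⁺(v,1), …, Γ⁺(v,d⁺(v))]   (heads of outgoing edges, in order)
--   inn v = [Γ⁻(v,1), …, Γ⁻(v,d⁻(v))]   (tails of incoming edges, in order)
record Digraph (n : ℕ) : Set where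
  field
    out : Fin n → List (Fin n)
    inn : Fin n → List (Fin n)

open Digraph public

countV : ∀ {n} → Fin n → List (Fin n) → ℕ
countV y [] = 0
countV y (z ∷ zs) = if does (y ≟ z) then suc (countV y zs) else countV y zs

mult : ∀ {n} → Digraph n → Fin n → Fin n → ℕ
mult G x y = countV y (out G x)

-- well-formedness: the out-lists and in-lists describe the same multiset of edges
Consistent : ∀ {n} → Digraph n → Set
Consistent G = ∀ x y → countV y (out G x) ≡ countV x (inn G y)

outdeg indeg : ∀ {n} → Digraph n → Fin n → ℕ
outdeg G v = length (out G v)
indeg G v = length (inn G v)

edgeCount : ∀ {n} → Digraph n → ℕ
edgeCount {n} G = sum (map (outdeg G) (allFin n))

data Path {n} (G : Digraph n) : Fin n → Fin n → Set where
  here : ∀ {x} → Path G x x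
  step : ∀ {x y z} → y ∈ out G x → Path G y z → Path G x z

StronglyConnected : ∀ {n} → Digraph n → Set
StronglyConnected G = ∀ x y → Path G x y

Eulerian : ∀ {n} → Digraph n → Set
Eulerian G = StronglyConnected G × (∀ v → outdeg G v ≡ indeg G v)

-- 1-based list indexing; nothing when out of range
nth : ∀ {A : Set} → List A → ℕ → Maybe A
nth [] _ = nothing
nth (x ∷ xs) zero = nothing
nth (x ∷ xs) (suc zero) = just x
nth (x ∷ xs) (suc (suc i)) = nth xs (suc i)

update : ∀ {n} {A : Set} → (Fin n → A) → Fin n → A → Fin n → A
update f x a y = if does (y ≟ x) then a else f y

-- equality test of a (possibly undefined) Γ⁺(u,i) with B[u];
-- B[u] = nothing encodes the value 0, which is no vertex
sameV : ∀ {n} → Maybe (Fin n) → Maybe (Fin n) → Bool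
sameV (just a) (just b) = does (a ≟ b)
sameV _ _ = false

record State (n : ℕ) : Set where
  constructor mkState
  field
    next    : Fin n → ℕ
    visited : Fin n → Bool
    skipped : Fin n → Bool
    B       : Fin n → Maybe (Fin n)   -- nothing ↔ 0
    c       : ℕ
    cur     : Fin n                   -- the variable u
    output  : List (Fin n × Fin n)

open State public

initState : ∀ {n} → Fin n → State n
initState v₀ = mkState (λ _ → 0) (update (λ _ → false) v₀ true) (λ _ → false)
                       (λ _ → nothing) 0 v₀ []

-- one iteration of the while loop; nothing if the algorithm would access
-- an undefined value (this never happens by the theorem)
hstep : ∀ {n} → Digraph n → Fin n → State n → Maybe (State n)
hstep {n} G v₀ s = branch (suc (next s (cur s)) ≤? indeg G (cur s))
  where
  u : Fin n
  u = cur s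
  nx : ℕ
  nx = suc (next s u)
  -- case i ≤ d⁻(u): move backwards along the nx-th incoming edge
  back : Maybe (Fin n) → Maybe (State n)
  back nothing = nothing
  back (just v) = just (mkState (update (next s) u nx)
                               (if visited s v then visited s else update (visited s) v true)
                               (skipped s)
                               (if visited s v then B s
                                else (if does (v ≟ v₀) then B s else update (B s) v (just u)))
                               (c s) v (output s))
  -- case i > d⁻(u): write an edge
  i : ℕ
  i = nx ∸ indeg G u
  skip : Bool
  skip = sameV (nth (out G u) i) (B s u) ∧ not (skipped s u)
  nx′ : ℕ
  nx′ = if skip then suc nx else nx
  i′ : ℕ
  i′ = if skip then suc i else i
  sk′ : Fin n → Bool
  sk′ = if skip then update (skipped s) u true else skipped s
  mv : Maybe (Fin n)
  mv = if does (outdeg G u <? i′) then B s u else nth (out G u) i′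
  fwd : Maybe (Fin n) → Maybe (State n)
  fwd nothing = nothing
  fwd (just v) = just (mkState (update (next s) u nx′) (visited s) sk′ (B s)
                               (suc (c s)) v (output s ++ [ (u , v) ]))
  branch : Dec (nx ≤ indeg G u) → Maybe (State n)
  branch (yes _) = back (nth (inn G u) nx)
  branch (no _) = fwd mv

-- run the while loop (while c < m) with a fuel bound; returns the output
-- if the loop has terminated within the given number of iterations
run : ∀ {n} → Digraph n → Fin n → ℕ → State n → Maybe (List (Fin n × Fin n))
run G v₀ k s with edgeCount G ≤? c s
run G v₀ k s | yes _ = just (output s)
run G v₀ zero s | no _ = nothing
run G v₀ (suc k) s | no _ with hstep G v₀ s
... | nothing = nothing
... | just s′ = run G v₀ k s′

consecutive : ∀ {n} → List (Fin n) → List (Fin n × Fin n)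
consecutive [] = []
consecutive (x ∷ []) = []
consecutive (x ∷ y ∷ ys) = (x , y) ∷ consecutive (y ∷ ys)

countE : ∀ {n} → Fin n → Fin n → List (Fin n × Fin n) → ℕ
countE x y [] = 0
countE x y ((a , b) ∷ es) =
  if does (x ≟ a) ∧ does (y ≟ b) then suc (countE x y es) else countE x y es

IsEulerianCycle : ∀ {n} → Digraph n → List (Fin n × Fin n) → Set
IsEulerianCycle {n} G es =
  ∃[ us ] ∃[ u₀ ] ∃[ mid ]
    (us ≡ u₀ ∷ mid ++ [ u₀ ]) × (es ≡ consecutive us)
    × (∀ x y → countE x y es ≡ mult G x y)

-- Backward moves (along in-edges) only explore: when a vertex is first reached its parent pointer
-- B is set, so the visited vertices form a tree rooted at v₀ along out-edges, and counting moves
-- shows that once the current vertex has no unexplored in-edge it is the head of the last written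
-- edge. Forward moves write the out-edges of a vertex in order but defer the tree edge to the very
-- end, so the output is always a trail from v₀. If the loop got stuck at v₀ with an edge still
-- unwritten, a path from that edge to v₀ would lead to a visited vertex with an unwritten edge, and
-- since tree edges are written last this would propagate down the tree to v₀. Every iteration
-- writes an edge or explores an in-edge, so the loop terminates.

{-# OPTIONS --safe #-}
module Submission where

open import Defs
import Algebra.Properties.CommutativeMonoid.Sum
open import Data.Nat using (ℕ; zero; suc; _+_; _∸_; _⊓_; _≤_; _<_; _≤?_; _<?_; z≤n; s≤s)
open import Data.Nat.Properties
  using ( ≤-refl; ≤-reflexive; ≤-trans; ≤-antisym; ≤-pred; <⇒≤; <⇒≢; ≤∧≢⇒<; ≮⇒≥; ≰⇒>; ≤⇒≯; <-≤-trans; <-irrefl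
        ; 1+n≰n; n≤1+n; n<1+n; m≤n⇒m≤1+n; m≤m+n; m≤n+m; +-comm; +-suc; +-identityʳ; +-cancelʳ-≡; +-cancelˡ-≡
        ; +-mono-≤; +-mono-<-≤; +-mono-≤-<; +-monoʳ-<; +-monoˡ-<; +-∸-assoc; ∸-monoʳ-<; m≤n⇒m∸n≡0; m∸n≢0⇒n<m
        ; 0∸n≡0; m≤n⇒m⊓n≡m; m≥n⇒m⊓n≡n; m⊓n≤n; +-0-commutativeMonoid; +-commutativeSemigroup; module ≤-Reasoning )
  renaming (_≟_ to _≟ℕ_)
open import Data.Nat.Induction using (<-wellFounded)
open import Data.Nat.ListAction using (sum)
open import Algebra.Properties.CommutativeSemigroup +-commutativeSemigroup using (xy∙z≈xz∙y)
open import Induction.WellFounded using (Acc; acc)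
open import Data.Fin using (Fin; _≟_; zero; suc)
open import Data.Bool using (Bool; true; false; if_then_else_; not; _∧_; _∨_)
open import Data.Bool.Properties using (∧-zeroʳ)
open import Data.Maybe using (Maybe; just; nothing)
open import Data.List using (List; []; _∷_; _++_; [_]; length; map; allFin; take; drop; tabulate)
open import Data.List.Properties
  using (length-++; length-++-sucʳ; ++-assoc; ++-identityʳ; map-tabulate; take++drop≡id; take-all)
open import Data.List.Relation.Unary.Any using (here; there)
open import Data.List.Membership.Propositional using (_∈_)
open import Data.List.Membership.Propositional.Properties using (∈-++⁺ˡ; ∈-++⁺ʳ; ∈-++⁻)
open import Data.Product using (_×_; _,_; proj₁; proj₂; ∃-syntax)
open import Data.Sum using (_⊎_; inj₁; inj₂)
open import Data.Empty using (⊥; ⊥-elim)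
open import Function using (_∘_; _$_)
open import Relation.Nullary using (Dec; yes; no; does; ¬_)
open import Relation.Nullary.Decidable using (dec-true; dec-false)
open import Relation.Binary.PropositionalEquality
  using (_≡_; _≢_; refl; sym; trans; cong; cong₂; subst; subst₂; ≢-sym; module ≡-Reasoning)

open Algebra.Properties.CommutativeMonoid.Sum +-0-commutativeMonoid
  using (∑-distrib-+; sum-cong-≗; sum-replicate-zero) renaming (sum to ∑)

private
  variable
    n : ℕ
    A : Set

δ : Fin n → Fin n → ℕ
δ x y = if does (x ≟ y) then 1 else 0

if-≟-≡ : {x y : Fin n} {a b : A} → x ≡ y → (if does (x ≟ y) then a else b) ≡ a
if-≟-≡ {x = x} {y} x≡y rewrite dec-true (x ≟ y) x≡y = refl

if-≟-≢ : {x y : Fin n} {a b : A} → x ≢ y → (if does (x ≟ y) then a else b) ≡ b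
if-≟-≢ {x = x} {y} x≢y rewrite dec-false (x ≟ y) x≢y = refl

δ-refl : (x : Fin n) → δ x x ≡ 1
δ-refl x = if-≟-≡ {x = x} refl

cancel-δ : {a b : ℕ} (w : Fin n) {x y : Fin n} → a + δ w x ≡ b + δ w y → x ≡ y → a ≡ b
cancel-δ w {x} eq refl = +-cancelʳ-≡ (δ w x) _ _ eq

δ≡1⇒≡ : {x y : Fin n} → δ x y ≡ 1 → x ≡ y
δ≡1⇒≡ {x = x} {y} δ≡1 with x ≟ y | δ≡1
... | yes x≡y | _ = x≡y
... | no  _   | ()

true≢false : true ≢ false
true≢false ()

distinct : {f : Fin n → Bool} {w x : Fin n} → f w ≡ true → f x ≡ false → w ≢ x
distinct fw fx refl = true≢false (trans (sym fw) fx)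

update-≡ : (f : Fin n → A) (x : Fin n) (a : A) → update f x a x ≡ a
update-≡ f x a = if-≟-≡ {x = x} refl

update-≢ : (f : Fin n → A) {x : Fin n} (a : A) {w : Fin n} → w ≢ x → update f x a w ≡ f w
update-≢ f a w≢x = if-≟-≢ w≢x

countV-∷ : (y z : Fin n) (zs : List (Fin n)) → countV y (z ∷ zs) ≡ δ y z + countV y zs
countV-∷ y z zs with does (y ≟ z)
... | true  = refl
... | false = refl

countV-++ : (y : Fin n) (xs ys : List (Fin n)) → countV y (xs ++ ys) ≡ countV y xs + countV y ys
countV-++ y []       ys = refl
countV-++ y (x ∷ xs) ys with does (y ≟ x)
... | true  = cong suc (countV-++ y xs ys)
... | false = countV-++ y xs ys

countV-insert : (y : Fin n) (xs : List (Fin n)) (z : Fin n) (ys : List (Fin n)) →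
                countV y (xs ++ z ∷ ys) ≡ δ y z + countV y (xs ++ ys)
countV-insert y []       z ys = countV-∷ y z ys
countV-insert y (x ∷ xs) z ys with does (y ≟ x)
... | true  = trans (cong suc (countV-insert y xs z ys)) (sym (+-suc (δ y z) _))
... | false = countV-insert y xs z ys

countV-snoc : (y : Fin n) (xs : List (Fin n)) (z : Fin n) → countV y (xs ++ [ z ]) ≡ countV y xs + δ y z
countV-snoc y xs z = begin
  countV y (xs ++ [ z ])       ≡⟨ countV-insert y xs z [] ⟩
  δ y z + countV y (xs ++ [])  ≡⟨ cong (λ l → δ y z + countV y l) (++-identityʳ xs) ⟩
  δ y z + countV y xs          ≡⟨ +-comm (δ y z) _ ⟩
  countV y xs + δ y z          ∎
  where open ≡-Reasoning

countV-prefix-≤ : (y : Fin n) (xs ys : List (Fin n)) → countV y xs ≤ countV y (xs ++ ys)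
countV-prefix-≤ y xs ys = ≤-trans (m≤m+n _ _) (≤-reflexive (sym (countV-++ y xs ys)))

countV-take-≤ : (y : Fin n) (k : ℕ) (L : List (Fin n)) → countV y (take k L) ≤ countV y L
countV-take-≤ y k L =
  subst (λ l → countV y (take k L) ≤ countV y l) (take++drop≡id k L) (countV-prefix-≤ y (take k L) (drop k L))

∈⇒countV>0 : {x : Fin n} {L : List (Fin n)} → x ∈ L → 0 < countV x L
∈⇒countV>0 {x = x} {_ ∷ zs} (here refl) rewrite countV-∷ x x zs | δ-refl x = s≤s z≤n
∈⇒countV>0 {x = x} {z ∷ zs} (there x∈zs) rewrite countV-∷ x z zs =
  <-≤-trans (∈⇒countV>0 x∈zs) (m≤n+m _ (δ x z))

countV>0⇒∈ : {x : Fin n} (L : List (Fin n)) → 0 < countV x L → x ∈ L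
countV>0⇒∈ {x = x} (z ∷ zs) pos with x ≟ z
... | yes refl = here refl
... | no _     = there (countV>0⇒∈ zs pos)

sum-tabulate : (f : Fin n → ℕ) → sum (tabulate f) ≡ ∑ f
sum-tabulate {zero}  f = refl
sum-tabulate {suc n} f = cong (f zero +_) (sum-tabulate (f ∘ suc))

sum-allFin : (f : Fin n → ℕ) → sum (map f (allFin n)) ≡ ∑ f
sum-allFin f = trans (cong sum (map-tabulate (λ i → i) f)) (sum-tabulate f)

∑-mono-≤ : {f g : Fin n → ℕ} → (∀ x → f x ≤ g x) → ∑ f ≤ ∑ g
∑-mono-≤ {zero}  f≤g = z≤n
∑-mono-≤ {suc n} f≤g = +-mono-≤ (f≤g zero) (∑-mono-≤ (f≤g ∘ suc))

∑-mono-< : {f g : Fin n → ℕ} → (∀ x → f x ≤ g x) → (w : Fin n) → f w < g w → ∑ f < ∑ g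
∑-mono-< {suc n} f≤g zero    fw<gw = +-mono-<-≤ fw<gw (∑-mono-≤ (f≤g ∘ suc))
∑-mono-< {suc n} f≤g (suc w) fw<gw = +-mono-≤-< (f≤g zero) (∑-mono-< (f≤g ∘ suc) w fw<gw)

∑-≤-≡⇒≡ : {f g : Fin n → ℕ} → (∀ x → f x ≤ g x) → ∑ f ≡ ∑ g → ∀ x → f x ≡ g x
∑-≤-≡⇒≡ {f = f} {g} f≤g ∑f≡∑g w with f w ≟ℕ g w
... | yes fw≡gw = fw≡gw
... | no  fw≢gw = ⊥-elim (<⇒≢ (∑-mono-< f≤g w (≤∧≢⇒< (f≤g w) fw≢gw)) ∑f≡∑g)

∑-<⇒∃< : (f g : Fin n → ℕ) → ∑ f < ∑ g → ∃[ w ] f w < g w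
∑-<⇒∃< {suc n} f g ∑f<∑g with f zero <? g zero | ∑ (f ∘ suc) <? ∑ (g ∘ suc)
... | yes f₀<g₀ | _         = zero , f₀<g₀
... | no  _     | yes tail< = let w , fw<gw = ∑-<⇒∃< (f ∘ suc) (g ∘ suc) tail< in suc w , fw<gw
... | no  f₀≮g₀ | no  tail≮ = ⊥-elim (≤⇒≯ (+-mono-≤ (≮⇒≥ f₀≮g₀) (≮⇒≥ tail≮)) ∑f<∑g)

∑-indicator : (u : Fin n) (k : ℕ) → ∑ (λ y → if does (y ≟ u) then k else 0) ≡ k
∑-indicator {suc n} zero    k = trans (cong (k +_) (sum-replicate-zero n)) (+-identityʳ k)
∑-indicator {suc n} (suc u) k = ∑-indicator u k

∑-countV : (L : List (Fin n)) → ∑ (λ x → countV x L) ≡ length L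
∑-countV {n} [] = sum-replicate-zero n
∑-countV (z ∷ zs) = begin
  ∑ (λ x → countV x (z ∷ zs))           ≡⟨ sum-cong-≗ (λ x → countV-∷ x z zs) ⟩
  ∑ (λ x → δ x z + countV x zs)         ≡⟨ ∑-distrib-+ (λ x → δ x z) (λ x → countV x zs) ⟩
  ∑ (λ x → δ x z) + ∑ (λ x → countV x zs) ≡⟨ cong₂ _+_ (∑-indicator z 1) (∑-countV zs) ⟩
  suc (length zs)                        ∎
  where open ≡-Reasoning

length>0 : {x : A} {L : List A} → x ∈ L → 0 < length L
length>0 {L = _ ∷ _} _ = s≤s z≤n

length-snoc : (xs : List A) (x : A) → length (xs ++ [ x ]) ≡ suc (length xs)
length-snoc xs x = trans (length-++ xs) (+-comm (length xs) 1)

nth-mid : (xs : List A) (y : A) (ys : List A) → nth (xs ++ y ∷ ys) (suc (length xs)) ≡ just y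
nth-mid []       y ys = refl
nth-mid (x ∷ xs) y ys = nth-mid xs y ys

nth-mid₂ : (xs : List A) (x y : A) (ys : List A) → nth (xs ++ x ∷ y ∷ ys) (suc (suc (length xs))) ≡ just y
nth-mid₂ []       x y ys = refl
nth-mid₂ (z ∷ xs) x y ys = nth-mid₂ xs x y ys

nth≡just⇒≤length : (L : List A) (i : ℕ) {v : A} → nth L i ≡ just v → i ≤ length L
nth≡just⇒≤length []      _             ()
nth≡just⇒≤length (x ∷ L) zero          ()
nth≡just⇒≤length (x ∷ L) (suc zero)    _  = s≤s z≤n
nth≡just⇒≤length (x ∷ L) (suc (suc i)) e  = s≤s (nth≡just⇒≤length L (suc i) e)

nth-take : (k : ℕ) (L : List A) → suc k ≤ length L →
           ∃[ v ] nth L (suc k) ≡ just v × take (suc k) L ≡ take k L ++ [ v ] × v ∈ L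
nth-take zero    (x ∷ L) _ = x , refl , refl , here refl
nth-take (suc k) (x ∷ L) (s≤s k<L) with nth-take k L k<L
... | v , nth≡v , take≡ , v∈L = v , nth≡v , cong (x ∷_) take≡ , there v∈L

-- The writes at a single vertex

-- The forward branch of hstep at position i of the out-list L: its test skip, its index i′ and
-- the head mv it reads.
skipNow : List (Fin n) → Maybe (Fin n) → Bool → ℕ → Bool
skipNow L mb sk i = sameV (nth L i) mb ∧ not sk

advance : Bool → ℕ → ℕ
advance skip i = if skip then suc i else i

headAt : List (Fin n) → Maybe (Fin n) → ℕ → Maybe (Fin n)
headAt L mb i = if does (length L <? i) then mb else nth L i

headAt-nth : (L : List (Fin n)) (i : ℕ) {mb : Maybe (Fin n)} {v : Fin n} →
             nth L i ≡ just v → headAt L mb i ≡ just v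
headAt-nth L i nth≡v rewrite dec-false (length L <? i) (≤⇒≯ (nth≡just⇒≤length L i nth≡v)) = nth≡v

headAt-past : (L : List (Fin n)) (i : ℕ) {mb : Maybe (Fin n)} → length L < i → headAt L mb i ≡ mb
headAt-past L i L<i rewrite dec-true (length L <? i) L<i = refl

-- The heads written from a vertex u with out-list L and B[u] = mb follow L, except that the first
-- occurrence of b is deferred to the very end when mb = just b.  The indices are skipped[u],
-- the number k = next[u] ∸ d⁻(u) of consumed positions of L, and the heads os written so far.
data Schedule (L : List (Fin n)) (mb : Maybe (Fin n)) : Bool → ℕ → List (Fin n) → Set where
  unskipped : ∀ {k os} Rest → L ≡ os ++ Rest → k ≡ length os →
              (∀ {b} → mb ≡ just b → countV b os ≡ 0) → Schedule L mb false k os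
  skipping  : ∀ {k os b} P Q Rest → mb ≡ just b → countV b P ≡ 0 →
              L ≡ (P ++ b ∷ Q) ++ Rest → os ≡ P ++ Q → k ≡ length (P ++ b ∷ Q) →
              Schedule L mb true k os
  finished  : ∀ {k os b} P Q → mb ≡ just b → countV b P ≡ 0 →
              L ≡ P ++ b ∷ Q → os ≡ (P ++ Q) ++ [ b ] → k ≡ suc (length L) →
              Schedule L mb true k os

schedule-start : {L : List (Fin n)} {mb : Maybe (Fin n)} → Schedule L mb false 0 []
schedule-start {L = L} = unskipped L refl refl (λ _ → refl)

schedule-unstarted : {L : List (Fin n)} {mb : Maybe (Fin n)} {os : List (Fin n)} →
                     Schedule L mb false 0 os → os ≡ []
schedule-unstarted (unskipped {os = []} _ _ _ _) = refl

finished-length : {b : Fin n} (P Q : List (Fin n)) → length ((P ++ Q) ++ [ b ]) ≡ length (P ++ b ∷ Q)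
finished-length {b = b} P Q = trans (length-snoc (P ++ Q) b) (sym (length-++-sucʳ P b Q))

record NextWrite (L : List (Fin n)) (mb : Maybe (Fin n)) (sk : Bool) (os : List (Fin n)) (i : ℕ) (skip : Bool)
                 : Set where
  constructor nextWrite
  field
    head     : Fin n
    read     : headAt L mb (advance skip i) ≡ just head
    head∈    : head ∈ L
    schedule : Schedule L mb (skip ∨ sk) (advance skip i) (os ++ [ head ])

private
  unskipped-write : {mb : Maybe (Fin n)} (os : List (Fin n)) (x : Fin n) (Rest : List (Fin n)) →
    (∀ {b} → mb ≡ just b → countV b (os ++ [ x ]) ≡ 0) →
    NextWrite (os ++ x ∷ Rest) mb false os (suc (length os)) false
  unskipped-write os x Rest b∉os′ =
    nextWrite x (headAt-nth (os ++ x ∷ Rest) _ (nth-mid os x Rest)) (∈-++⁺ʳ os (here refl)) $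
    unskipped Rest (sym (++-assoc os [ x ] Rest)) (sym (length-snoc os x)) b∉os′

schedule-step : {L : List (Fin n)} {mb : Maybe (Fin n)} {sk : Bool} {k : ℕ} {os : List (Fin n)} →
                Schedule L mb sk k os → length os < length L →
                NextWrite L mb sk os (suc k) (skipNow L mb sk (suc k))
schedule-step {os = os} (unskipped [] refl refl _) os<L =
  ⊥-elim (<-irrefl (sym (cong length (++-identityʳ os))) os<L)
schedule-step {mb = nothing} {os = os} (unskipped (x ∷ Rest) refl refl _) _
  rewrite nth-mid os x Rest = unskipped-write os x Rest (λ ())
schedule-step {mb = just b} {os = os} (unskipped (x ∷ Rest) refl refl b∉os) _
  rewrite nth-mid os x Rest with x ≟ b
... | no x≢b = unskipped-write os x Rest λ { refl →
        trans (countV-snoc b os x) (cong₂ _+_ (b∉os refl) (if-≟-≢ (x≢b ∘ sym))) }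
... | yes refl with Rest
...   | []    = nextWrite x (headAt-past (os ++ [ x ]) _ (s≤s (≤-reflexive (length-snoc os x))))
                          (∈-++⁺ʳ os (here refl)) $
                finished os [] refl (b∉os refl) refl (cong (_++ [ x ]) (sym (++-identityʳ os)))
                         (cong suc (sym (length-snoc os x)))
...   | y ∷ R = nextWrite y (headAt-nth (os ++ x ∷ y ∷ R) _ (nth-mid₂ os x y R))
                          (∈-++⁺ʳ os (there (here refl))) $
                skipping os [ y ] R refl (b∉os refl) (sym (++-assoc os (x ∷ [ y ]) R)) refl
                         (sym (trans (length-++ os) (+-comm (length os) 2)))
schedule-step (skipping {b = b} P Q Rest refl b∉P refl refl refl) _
  rewrite ∧-zeroʳ (sameV (nth ((P ++ b ∷ Q) ++ Rest) (suc (length (P ++ b ∷ Q)))) (just b)) with Rest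
... | []    = nextWrite b (headAt-past ((P ++ b ∷ Q) ++ []) _ (s≤s (≤-reflexive (cong length L≡))))
                          (∈-++⁺ˡ (∈-++⁺ʳ P (here refl))) $
              finished P Q refl b∉P L≡ refl (cong (suc ∘ length) (sym L≡))
  where
  L≡ : (P ++ b ∷ Q) ++ [] ≡ P ++ b ∷ Q
  L≡ = ++-identityʳ (P ++ b ∷ Q)
... | y ∷ R = nextWrite y (headAt-nth ((P ++ b ∷ Q) ++ y ∷ R) _ (nth-mid (P ++ b ∷ Q) y R))
                          (∈-++⁺ʳ (P ++ b ∷ Q) (here refl)) $
              skipping P (Q ++ [ y ]) R refl b∉P L≡ (++-assoc P Q [ y ]) k≡
  where
  L≡ : (P ++ b ∷ Q) ++ y ∷ R ≡ (P ++ b ∷ Q ++ [ y ]) ++ R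
  L≡ = trans (sym (++-assoc (P ++ b ∷ Q) [ y ] R)) (cong (_++ R) (++-assoc P (b ∷ Q) [ y ]))
  k≡ : suc (length (P ++ b ∷ Q)) ≡ length (P ++ b ∷ Q ++ [ y ])
  k≡ = trans (sym (length-snoc (P ++ b ∷ Q) y)) (cong length (++-assoc P (b ∷ Q) [ y ]))
schedule-step (finished P Q _ _ refl refl _) os<L = ⊥-elim (<-irrefl (finished-length P Q) os<L)

module _ {L : List (Fin n)} {mb : Maybe (Fin n)} {sk : Bool} {k : ℕ} {os : List (Fin n)} where

  schedule-countV-≤ : Schedule L mb sk k os → (y : Fin n) → countV y os ≤ countV y L
  schedule-countV-≤ (unskipped Rest refl _ _) y = countV-prefix-≤ y os Rest
  schedule-countV-≤ (skipping {b = b} P Q Rest _ _ refl refl _) y = begin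
    countV y (P ++ Q)               ≤⟨ m≤n+m _ (δ y b) ⟩
    δ y b + countV y (P ++ Q)       ≡⟨ countV-insert y P b Q ⟨
    countV y (P ++ b ∷ Q)           ≤⟨ countV-prefix-≤ y (P ++ b ∷ Q) Rest ⟩
    countV y ((P ++ b ∷ Q) ++ Rest) ∎
    where open ≤-Reasoning
  schedule-countV-≤ (finished {b = b} P Q _ _ refl refl _) y = ≤-reflexive (begin
    countV y ((P ++ Q) ++ [ b ]) ≡⟨ countV-snoc y (P ++ Q) b ⟩
    countV y (P ++ Q) + δ y b    ≡⟨ +-comm _ (δ y b) ⟩
    δ y b + countV y (P ++ Q)    ≡⟨ countV-insert y P b Q ⟨
    countV y (P ++ b ∷ Q)        ∎)
    where open ≡-Reasoning

  schedule-length-≤ : Schedule L mb sk k os → length os ≤ length L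
  schedule-length-≤ sched = subst₂ _≤_ (∑-countV os) (∑-countV L) (∑-mono-≤ (schedule-countV-≤ sched))

  schedule-length-≤-position : Schedule L mb sk k os → length os ≤ k
  schedule-length-≤-position (unskipped _ _ refl _) = ≤-refl
  schedule-length-≤-position (skipping {b = b} P Q _ _ _ _ refl refl) =
    ≤-trans (n≤1+n _) (≤-reflexive (sym (length-++-sucʳ P b Q)))
  schedule-length-≤-position sched@(finished _ _ _ _ _ _ refl) = m≤n⇒m≤1+n (schedule-length-≤ sched)

  schedule-complete : Schedule L mb sk k os → length os ≡ length L → (y : Fin n) → countV y os ≡ countV y L
  schedule-complete sched os≡L =
    ∑-≤-≡⇒≡ (schedule-countV-≤ sched) (trans (∑-countV os) (trans os≡L (sym (∑-countV L))))

schedule-deferred-pending : {L : List (Fin n)} {p : Fin n} {sk : Bool} {k : ℕ} {os : List (Fin n)} →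
  Schedule L (just p) sk k os → p ∈ L → length os < length L → countV p os < countV p L
schedule-deferred-pending {L = L} (unskipped _ _ _ p∉os) p∈L _ =
  subst (_< countV _ L) (sym (p∉os refl)) (∈⇒countV>0 p∈L)
schedule-deferred-pending {p = p} (skipping P Q Rest refl _ refl refl _) _ _ = begin-strict
  countV p (P ++ Q)               <⟨ n<1+n _ ⟩
  suc (countV p (P ++ Q))         ≡⟨ trans (countV-insert p P p Q) (cong (_+ countV p (P ++ Q)) (δ-refl p)) ⟨
  countV p (P ++ p ∷ Q)           ≤⟨ countV-prefix-≤ p (P ++ p ∷ Q) Rest ⟩
  countV p ((P ++ p ∷ Q) ++ Rest) ∎
  where open ≤-Reasoning
schedule-deferred-pending (finished P Q _ _ refl refl _) _ os<L = ⊥-elim (<-irrefl (finished-length P Q) os<L)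

-- Edge lists and trails

headsFrom : Fin n → List (Fin n × Fin n) → List (Fin n)
headsFrom u []             = []
headsFrom u ((x , y) ∷ es) = if does (u ≟ x) then y ∷ headsFrom u es else headsFrom u es

headsFrom-snoc : (u : Fin n) (es : List (Fin n × Fin n)) (x y : Fin n) →
                 headsFrom u (es ++ [ (x , y) ]) ≡ headsFrom u es ++ (if does (u ≟ x) then [ y ] else [])
headsFrom-snoc u []             x y = refl
headsFrom-snoc u ((a , b) ∷ es) x y with does (u ≟ a)
... | true  = cong (b ∷_) (headsFrom-snoc u es x y)
... | false = headsFrom-snoc u es x y

countV-headsFrom-snoc : (w u : Fin n) (es : List (Fin n × Fin n)) (x y : Fin n) →
  countV w (headsFrom u (es ++ [ (x , y) ])) ≡ countV w (headsFrom u es) + (if does (u ≟ x) then δ w y else 0)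
countV-headsFrom-snoc w u es x y rewrite headsFrom-snoc u es x y with does (u ≟ x)
... | true  = countV-snoc w (headsFrom u es) y
... | false = countV-++ w (headsFrom u es) []

length-headsFrom-snoc : (u : Fin n) (es : List (Fin n × Fin n)) (x y : Fin n) →
  length (headsFrom u (es ++ [ (x , y) ])) ≡ length (headsFrom u es) + δ u x
length-headsFrom-snoc u es x y rewrite headsFrom-snoc u es x y with does (u ≟ x)
... | true  = length-++ (headsFrom u es)
... | false = length-++ (headsFrom u es)

countE≡countV-headsFrom : (x y : Fin n) (es : List (Fin n × Fin n)) → countE x y es ≡ countV y (headsFrom x es)
countE≡countV-headsFrom x y []             = refl
countE≡countV-headsFrom x y ((a , b) ∷ es) with does (x ≟ a)
... | false = countE≡countV-headsFrom x y es
... | true with does (y ≟ b)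
...   | true  = cong suc (countE≡countV-headsFrom x y es)
...   | false = countE≡countV-headsFrom x y es

∑-length-headsFrom : (es : List (Fin n × Fin n)) → ∑ (λ u → length (headsFrom u es)) ≡ length es
∑-length-headsFrom {n} []             = sum-replicate-zero n
∑-length-headsFrom     ((a , b) ∷ es) = begin
  ∑ (λ u → length (headsFrom u ((a , b) ∷ es)))       ≡⟨ sum-cong-≗ length-headsFrom-∷ ⟩
  ∑ (λ u → δ u a + length (headsFrom u es))           ≡⟨ ∑-distrib-+ (λ u → δ u a) _ ⟩
  ∑ (λ u → δ u a) + ∑ (λ u → length (headsFrom u es)) ≡⟨ cong₂ _+_ (∑-indicator a 1) (∑-length-headsFrom es) ⟩
  suc (length es)                                     ∎
  where
  open ≡-Reasoning
  length-headsFrom-∷ : ∀ u → length (headsFrom u ((a , b) ∷ es)) ≡ δ u a + length (headsFrom u es)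
  length-headsFrom-∷ u with does (u ≟ a)
  ... | true  = refl
  ... | false = refl

data Trail (x : Fin n) : List (Fin n × Fin n) → Fin n → Set where
  []  : Trail x [] x
  _▷_ : ∀ {es y} → Trail x es y → (z : Fin n) → Trail x (es ++ [ (y , z) ]) z

consecutive-snoc : (xs : List (Fin n)) (y z : Fin n) →
                   consecutive (xs ++ [ y ]) ++ [ (y , z) ] ≡ consecutive ((xs ++ [ y ]) ++ [ z ])
consecutive-snoc []           y z = refl
consecutive-snoc (x ∷ [])     y z = refl
consecutive-snoc (x ∷ x′ ∷ xs) y z = cong ((x , x′) ∷_) (consecutive-snoc (x′ ∷ xs) y z)

trail-snoc-consecutive : {x y : Fin n} {es : List (Fin n × Fin n)} → Trail x es y → (z : Fin n) →
                         ∃[ mid ] es ++ [ (y , z) ] ≡ consecutive (x ∷ mid ++ [ z ])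
trail-snoc-consecutive []      z = [] , refl
trail-snoc-consecutive {x = x} (t ▷ y) z with trail-snoc-consecutive t y
... | mid , es≡ = mid ++ [ y ] , trans (cong (_++ [ (y , z) ]) es≡) (consecutive-snoc (x ∷ mid) y z)

trail-consecutive : {x y : Fin n} {es : List (Fin n × Fin n)} → Trail x es y →
                    es ≡ [] ⊎ ∃[ mid ] es ≡ consecutive (x ∷ mid ++ [ y ])
trail-consecutive []      = inj₁ refl
trail-consecutive (t ▷ z) = inj₂ (trail-snoc-consecutive t z)

trail-balance : {x y : Fin n} {es : List (Fin n × Fin n)} → Trail x es y → (w : Fin n) →
                ∑ (λ u → countV w (headsFrom u es)) + δ w x ≡ length (headsFrom w es) + δ w y
trail-balance {n} {x = x} [] w = cong (_+ δ w x) (sum-replicate-zero n)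
trail-balance {n} {x = x} (_▷_ {es} {y} t z) w = begin
  into (es ++ [ (y , z) ]) + δ w x                  ≡⟨ cong (_+ δ w x) into-snoc ⟩
  into es + δ w z + δ w x                           ≡⟨ xy∙z≈xz∙y (into es) (δ w z) (δ w x) ⟩
  into es + δ w x + δ w z                           ≡⟨ cong (_+ δ w z) (trail-balance t w) ⟩
  length (headsFrom w es) + δ w y + δ w z           ≡⟨ cong (_+ δ w z) (length-headsFrom-snoc w es y z) ⟨
  length (headsFrom w (es ++ [ (y , z) ])) + δ w z  ∎
  where
  open ≡-Reasoning
  into : List (Fin n × Fin n) → ℕ
  into es′ = ∑ (λ u → countV w (headsFrom u es′))
  into-snoc : into (es ++ [ (y , z) ]) ≡ into es + δ w z
  into-snoc = begin
    into (es ++ [ (y , z) ])                                ≡⟨ sum-cong-≗ (λ u → countV-headsFrom-snoc w u es y z) ⟩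
    ∑ (λ u → countV w (headsFrom u es) + (if does (u ≟ y) then δ w z else 0))
      ≡⟨ ∑-distrib-+ (λ u → countV w (headsFrom u es)) (λ u → if does (u ≟ y) then δ w z else 0) ⟩
    into es + ∑ (λ u → if does (u ≟ y) then δ w z else 0)  ≡⟨ cong (into es +_) (∑-indicator y (δ w z)) ⟩
    into es + δ w z                                         ∎

-- Correctness of Space-Efficient-Hierholzer

module Hierholzer {n : ℕ} (G : Digraph n) (v₀ : Fin n) (consistent : Consistent G) (eulerian : Eulerian G)
  where

  m : ℕ
  m = edgeCount G

  outdeg≡indeg : ∀ u → outdeg G u ≡ indeg G u
  outdeg≡indeg = proj₂ eulerian

  m≡∑outdeg : m ≡ ∑ (outdeg G)
  m≡∑outdeg = sum-allFin (outdeg G)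

  indeg≡∑countV : ∀ w → ∑ (λ x → countV w (out G x)) ≡ indeg G w
  indeg≡∑countV w = trans (sum-cong-≗ (λ x → consistent x w)) (∑-countV (inn G w))

  outdeg≡∑countV : ∀ w → ∑ (λ y → countV w (inn G y)) ≡ outdeg G w
  outdeg≡∑countV w = trans (sum-cong-≗ (λ y → sym (consistent w y))) (∑-countV (out G w))

  out⇒inn : ∀ {x y} → y ∈ out G x → x ∈ inn G y
  out⇒inn {x} {y} y∈ = countV>0⇒∈ (inn G y) (subst (0 <_) (consistent x y) (∈⇒countV>0 y∈))

  inn⇒out : ∀ {x y} → x ∈ inn G y → y ∈ out G x
  inn⇒out {x} {y} x∈ = countV>0⇒∈ (out G x) (subst (0 <_) (sym (consistent x y)) (∈⇒countV>0 x∈))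

  -- next[u] counts first the in-edges of u traversed backwards, then the consumed positions of
  -- its out-list.
  backFrom position : State n → Fin n → ℕ
  backFrom s u = next s u ⊓ indeg G u
  position s u = next s u ∸ indeg G u

  explored : State n → Fin n → List (Fin n)
  explored s y = take (backFrom s y) (inn G y)

  backInto : State n → Fin n → ℕ
  backInto s w = ∑ (λ y → countV w (explored s y))

  written : State n → Fin n → List (Fin n)
  written s u = headsFrom u (output s)

  writtenFrom writtenInto : State n → Fin n → ℕ
  writtenFrom s u = length (written s u)
  writtenInto s w = ∑ (λ x → countV w (written s x))

  μ : State n → ℕ
  μ s = (m ∸ c s) + (m ∸ ∑ (backFrom s))

  -- backBalance: as a multiset of edges, the backward moves form closed walks plus a walk from
  -- tip to cur.
  record Invariant (s : State n) : Set where
    field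
      tip            : Fin n
      rank           : Fin n → ℕ
      rankBound      : ℕ
      c≡length       : c s ≡ length (output s)
      trail          : Trail v₀ (output s) tip
      backBalance    : ∀ w → backInto s w + δ w tip ≡ backFrom s w + δ w (cur s)
      curVisited     : visited s (cur s) ≡ true
      v₀Visited      : visited s v₀ ≡ true
      backVisited    : ∀ y x → x ∈ explored s y → visited s x ≡ true
      parent         : ∀ w → visited s w ≡ true → w ≢ v₀ →
                       ∃[ p ] B s w ≡ just p × visited s p ≡ true × rank p < rank w × p ∈ out G w
      rank<bound     : ∀ w → visited s w ≡ true → rank w < rankBound
      unvisitedFresh : ∀ w → visited s w ≡ false → next s w ≡ 0 × skipped s w ≡ false
      schedule       : ∀ u → Schedule (out G u) (B s u) (skipped s u) (position s u) (written s u)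

  module _ {s : State n} (inv : Invariant s) where
    open Invariant inv

    writtenFrom≤outdeg : ∀ u → writtenFrom s u ≤ outdeg G u
    writtenFrom≤outdeg u = schedule-length-≤ (schedule u)

    writtenInto≤indeg : ∀ w → writtenInto s w ≤ indeg G w
    writtenInto≤indeg w =
      subst (writtenInto s w ≤_) (indeg≡∑countV w) (∑-mono-≤ (λ x → schedule-countV-≤ (schedule x) w))

    backInto≤outdeg : ∀ w → backInto s w ≤ outdeg G w
    backInto≤outdeg w =
      subst (backInto s w ≤_) (outdeg≡∑countV w) (∑-mono-≤ (λ y → countV-take-≤ w (backFrom s y) (inn G y)))

    ∑writtenFrom≡c : ∑ (writtenFrom s) ≡ c s
    ∑writtenFrom≡c = trans (∑-length-headsFrom (output s)) (sym c≡length)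

    writeBalance : ∀ w → writtenInto s w + δ w v₀ ≡ writtenFrom s w + δ w tip
    writeBalance = trail-balance trail

    stalled⇒cur≡tip : indeg G (cur s) ≤ next s (cur s) → cur s ≡ tip
    stalled⇒cur≡tip stalled with cur s ≟ tip
    ... | yes cur≡tip = cur≡tip
    ... | no  cur≢tip = ⊥-elim (1+n≰n (begin
      suc (indeg G u)             ≡⟨ +-comm 1 (indeg G u) ⟩
      indeg G u + 1               ≡⟨ cong₂ _+_ (m≥n⇒m⊓n≡n stalled) (δ-refl u) ⟨
      backFrom s u + δ u u        ≡⟨ backBalance u ⟨
      backInto s u + δ u tip      ≡⟨ cong (backInto s u +_) (if-≟-≢ cur≢tip) ⟩
      backInto s u + 0            ≡⟨ +-identityʳ _ ⟩
      backInto s u                ≤⟨ backInto≤outdeg u ⟩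
      outdeg G u                  ≡⟨ outdeg≡indeg u ⟩
      indeg G u                   ∎))
      where
      open ≤-Reasoning
      u : Fin n
      u = cur s

    module AtTip (cur≡tip : cur s ≡ tip) where

      backInto≡backFrom : ∀ w → backInto s w ≡ backFrom s w
      backInto≡backFrom w = cancel-δ w (backBalance w) (sym cur≡tip)

      -- At the tip, backward moves into cur balance those out of it; once cur has no unexplored
      -- in-edge, every edge leaving cur has therefore been traversed backwards from its head.
      out-visited : indeg G (cur s) ≤ next s (cur s) → ∀ {v} → v ∈ out G (cur s) → visited s v ≡ true
      out-visited stalled {v} v∈ with visited s v in vis
      ... | true  = refl
      ... | false = ⊥-elim (<-irrefl (trans (sym unexplored) all-explored) (∈⇒countV>0 (out⇒inn v∈)))
        where
        u : Fin n
        u = cur s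
        backInto-u : backInto s u ≡ ∑ (λ y → countV u (inn G y))
        backInto-u = begin
          backInto s u                  ≡⟨ backInto≡backFrom u ⟩
          backFrom s u                  ≡⟨ m≥n⇒m⊓n≡n stalled ⟩
          indeg G u                     ≡⟨ outdeg≡indeg u ⟨
          outdeg G u                    ≡⟨ outdeg≡∑countV u ⟨
          ∑ (λ y → countV u (inn G y))  ∎
          where open ≡-Reasoning
        all-explored : countV u (explored s v) ≡ countV u (inn G v)
        all-explored = ∑-≤-≡⇒≡ (λ y → countV-take-≤ u (backFrom s y) (inn G y)) backInto-u v
        unexplored : countV u (explored s v) ≡ 0
        unexplored rewrite proj₁ (unvisitedFresh v vis) = refl

    written⇒stalled : ∀ y → 0 < writtenFrom s y → backFrom s y ≡ indeg G y
    written⇒stalled y pos = m≥n⇒m⊓n≡n (<⇒≤ (m∸n≢0⇒n<m (≢-sym (<⇒≢ 0<position))))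
      where
      0<position : 0 < position s y
      0<position = <-≤-trans pos (schedule-length-≤-position (schedule y))

    module Closed (tip≡v₀ : tip ≡ v₀) (v₀-done : writtenFrom s v₀ ≡ outdeg G v₀) where

      writtenInto≡writtenFrom : ∀ w → writtenInto s w ≡ writtenFrom s w
      writtenInto≡writtenFrom w = cancel-δ w (writeBalance w) (sym tip≡v₀)

      -- The edge to the parent is written last, so an unfinished vertex has an unfinished parent.
      parent-unfinished : ∀ w → visited s w ≡ true → w ≢ v₀ → writtenFrom s w < outdeg G w →
                          ∃[ p ] visited s p ≡ true × rank p < rank w × writtenFrom s p < outdeg G p
      parent-unfinished w vis w≢v₀ unfinished with parent w vis w≢v₀
      ... | p , B≡p , vis-p , rank< , p∈ = p , vis-p , rank< , (begin-strict
        writtenFrom s p  ≡⟨ writtenInto≡writtenFrom p ⟨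
        writtenInto s p  <⟨ ∑-mono-< (λ x → schedule-countV-≤ (schedule x) p) w pending ⟩
        ∑ (λ x → countV p (out G x)) ≡⟨ indeg≡∑countV p ⟩
        indeg G p        ≡⟨ outdeg≡indeg p ⟨
        outdeg G p       ∎)
        where
        open ≤-Reasoning
        pending : countV p (written s w) < countV p (out G w)
        pending = schedule-deferred-pending
          (subst (λ b → Schedule (out G w) b (skipped s w) (position s w) (written s w)) B≡p (schedule w))
          p∈ unfinished

      visited-finished : ∀ w → visited s w ≡ true → ¬ writtenFrom s w < outdeg G w
      visited-finished w = go w (<-wellFounded (rank w))
        where
        go : ∀ w → Acc _<_ (rank w) → visited s w ≡ true → ¬ writtenFrom s w < outdeg G w
        go w (acc smaller) vis unfinished with w ≟ v₀
        ... | yes refl    = <-irrefl v₀-done unfinished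
        ... | no  w≢v₀ with parent-unfinished w vis w≢v₀ unfinished
        ...   | p , vis-p , rank< , p-unfinished = go p (smaller rank<) vis-p p-unfinished

      -- The first visited vertex on a path from an unvisited vertex to v₀ still has an
      -- unwritten edge: otherwise all its in-edges, including the one from its unvisited
      -- predecessor, would have been traversed backwards.
      unvisited⇒unfinished : ∀ {x} → Path G x v₀ → visited s x ≡ false →
                             ∃[ y ] visited s y ≡ true × writtenFrom s y < outdeg G y
      unvisited⇒unfinished here unvis = ⊥-elim (true≢false (trans (sym v₀Visited) unvis))
      unvisited⇒unfinished {x} (step {y = y} y∈ path) unvis with visited s y in vis-y
      ... | false = unvisited⇒unfinished path vis-y
      ... | true with writtenFrom s y <? outdeg G y
      ...   | yes unfinished = y , vis-y , unfinished
      ...   | no  done = ⊥-elim (true≢false (trans (sym (backVisited y x x∈explored)) unvis))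
        where
        x∈inn : x ∈ inn G y
        x∈inn = out⇒inn y∈
        written>0 : 0 < writtenFrom s y
        written>0 = <-≤-trans (length>0 x∈inn) (subst (_≤ writtenFrom s y) (outdeg≡indeg y) (≮⇒≥ done))
        x∈explored : x ∈ explored s y
        x∈explored rewrite written⇒stalled y written>0 | take-all (indeg G y) (inn G y) ≤-refl = x∈inn

      complete : m ≤ c s
      complete = ≮⇒≥ λ c<m → let w , unfinished = ∑-<⇒∃< (writtenFrom s) (outdeg G) (∑w<∑d c<m) in
        unfinished-absurd w unfinished
        where
        ∑w<∑d : c s < m → ∑ (writtenFrom s) < ∑ (outdeg G)
        ∑w<∑d c<m = subst₂ _<_ (sym ∑writtenFrom≡c) m≡∑outdeg c<m
        unfinished-absurd : ∀ w → writtenFrom s w < outdeg G w → ⊥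
        unfinished-absurd w unfinished with visited s w in vis
        ... | true  = visited-finished w vis unfinished
        ... | false with unvisited⇒unfinished (proj₁ eulerian w v₀) vis
        ...   | y , vis-y , y-unfinished = visited-finished y vis-y y-unfinished

    stalled-unfinished : indeg G (cur s) ≤ next s (cur s) → c s < m → writtenFrom s (cur s) < outdeg G (cur s)
    stalled-unfinished stalled c<m with cur s ≟ v₀ | writtenFrom s (cur s) <? outdeg G (cur s)
    ... | _        | yes unfinished = unfinished
    ... | yes u≡v₀ | no  done = ⊥-elim (≤⇒≯ (Closed.complete tip≡v₀ v₀-done) c<m)
      where
      tip≡v₀ : tip ≡ v₀
      tip≡v₀ = trans (sym (stalled⇒cur≡tip stalled)) u≡v₀
      v₀-done : writtenFrom s v₀ ≡ outdeg G v₀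
      v₀-done = subst (λ u → writtenFrom s u ≡ outdeg G u) u≡v₀ (≤-antisym (writtenFrom≤outdeg (cur s)) (≮⇒≥ done))
    ... | no  u≢v₀ | no  done = ⊥-elim (done (begin-strict
      writtenFrom s u             <⟨ n<1+n _ ⟩
      suc (writtenFrom s u)       ≡⟨ +-comm 1 _ ⟩
      writtenFrom s u + 1         ≡⟨ cong (writtenFrom s u +_) (δ-refl u) ⟨
      writtenFrom s u + δ u u     ≡⟨ cong (λ t → writtenFrom s u + δ u t) (stalled⇒cur≡tip stalled) ⟩
      writtenFrom s u + δ u tip   ≡⟨ writeBalance u ⟨
      writtenInto s u + δ u v₀    ≡⟨ cong (writtenInto s u +_) (if-≟-≢ u≢v₀) ⟩
      writtenInto s u + 0         ≡⟨ +-identityʳ _ ⟩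
      writtenInto s u             ≤⟨ writtenInto≤indeg u ⟩
      indeg G u                   ≡⟨ outdeg≡indeg u ⟨
      outdeg G u                  ∎))
      where
      open ≤-Reasoning
      u : Fin n
      u = cur s

  backState : State n → Fin n → State n
  backState s v =
    mkState (update (next s) (cur s) (suc (next s (cur s))))
            (if visited s v then visited s else update (visited s) v true)
            (skipped s)
            (if visited s v then B s else (if does (v ≟ v₀) then B s else update (B s) v (just (cur s))))
            (c s) v (output s)

  hstep-back : ∀ s {v} → suc (next s (cur s)) ≤ indeg G (cur s) →
               nth (inn G (cur s)) (suc (next s (cur s))) ≡ just v → hstep G v₀ s ≡ just (backState s v)
  hstep-back s room nth≡v with suc (next s (cur s)) ≤? indeg G (cur s)
  ... | yes _       rewrite nth≡v = refl
  ... | no  no-room = ⊥-elim (no-room room)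

  skipHere : State n → Bool
  skipHere s = skipNow (out G (cur s)) (B s (cur s)) (skipped s (cur s)) (suc (next s (cur s)) ∸ indeg G (cur s))

  forwardState : State n → Fin n → State n
  forwardState s v =
    mkState (update (next s) (cur s) (advance (skipHere s) (suc (next s (cur s)))))
            (visited s)
            (if skipHere s then update (skipped s) (cur s) true else skipped s)
            (B s) (suc (c s)) v (output s ++ [ (cur s , v) ])

  hstep-forward : ∀ s {v} → ¬ suc (next s (cur s)) ≤ indeg G (cur s) →
    headAt (out G (cur s)) (B s (cur s)) (advance (skipHere s) (suc (next s (cur s)) ∸ indeg G (cur s)))
      ≡ just v →
    hstep G v₀ s ≡ just (forwardState s v)
  hstep-forward s no-room head≡v with suc (next s (cur s)) ≤? indeg G (cur s)
  ... | yes room = ⊥-elim (no-room room)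
  ... | no  _    rewrite head≡v = refl

  Progress : State n → Set
  Progress s = ∃[ s′ ] hstep G v₀ s ≡ just s′ × Invariant s′ × μ s′ < μ s

  module Back (s : State n) (inv : Invariant s) (room : suc (next s (cur s)) ≤ indeg G (cur s))
              {v : Fin n} (nth≡v : nth (inn G (cur s)) (suc (next s (cur s))) ≡ just v)
              (take≡ : take (suc (next s (cur s))) (inn G (cur s)) ≡ take (next s (cur s)) (inn G (cur s)) ++ [ v ])
              (v∈ : v ∈ inn G (cur s)) where
    open Invariant inv

    u : Fin n
    u = cur s

    moved : State n
    moved = record s { next = update (next s) u (suc (next s u)) ; cur = v }

    backFrom-u : backFrom s u ≡ next s u
    backFrom-u = m≤n⇒m⊓n≡m (<⇒≤ room)

    backFrom-moved : ∀ w → backFrom moved w ≡ backFrom s w + δ w u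
    backFrom-moved w with w ≟ u
    ... | yes refl = trans (m≤n⇒m⊓n≡m room) (trans (cong suc (sym backFrom-u)) (+-comm 1 _))
    ... | no  _    = sym (+-identityʳ _)

    position-moved : ∀ w → position moved w ≡ position s w
    position-moved w with w ≟ u
    ... | yes refl = trans (m≤n⇒m∸n≡0 room) (sym (m≤n⇒m∸n≡0 (<⇒≤ room)))
    ... | no  _    = refl

    explored-moved : ∀ y → explored moved y ≡ explored s y ++ (if does (y ≟ u) then [ v ] else [])
    explored-moved y with y ≟ u
    ... | yes refl rewrite m≤n⇒m⊓n≡m room | backFrom-u = take≡
    ... | no  _    = sym (++-identityʳ _)

    backInto-moved : ∀ w → backInto moved w ≡ backInto s w + δ w v
    backInto-moved w = begin
      backInto moved w                                                      ≡⟨ sum-cong-≗ entry ⟩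
      ∑ (λ y → countV w (explored s y) + (if does (y ≟ u) then δ w v else 0))
        ≡⟨ ∑-distrib-+ (λ y → countV w (explored s y)) (λ y → if does (y ≟ u) then δ w v else 0) ⟩
      backInto s w + ∑ (λ y → if does (y ≟ u) then δ w v else 0)           ≡⟨ cong (backInto s w +_) (∑-indicator u (δ w v)) ⟩
      backInto s w + δ w v                                                  ∎
      where
      open ≡-Reasoning
      entry : ∀ y → countV w (explored moved y) ≡ countV w (explored s y) + (if does (y ≟ u) then δ w v else 0)
      entry y rewrite explored-moved y | countV-++ w (explored s y) (if does (y ≟ u) then [ v ] else [])
        with does (y ≟ u)
      ... | true  = refl
      ... | false = refl

    backBalance-moved : ∀ w → backInto moved w + δ w tip ≡ backFrom moved w + δ w v
    backBalance-moved w = begin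
      backInto moved w + δ w tip      ≡⟨ cong (_+ δ w tip) (backInto-moved w) ⟩
      backInto s w + δ w v + δ w tip  ≡⟨ xy∙z≈xz∙y (backInto s w) (δ w v) (δ w tip) ⟩
      backInto s w + δ w tip + δ w v  ≡⟨ cong (_+ δ w v) (backBalance w) ⟩
      backFrom s w + δ w u + δ w v    ≡⟨ cong (_+ δ w v) (backFrom-moved w) ⟨
      backFrom moved w + δ w v        ∎
      where open ≡-Reasoning

    backVisited-moved : (visited′ : Fin n → Bool) → (∀ w → visited s w ≡ true → visited′ w ≡ true) →
                        visited′ v ≡ true → ∀ y x → x ∈ explored moved y → visited′ x ≡ true
    backVisited-moved visited′ mono vis-v y x x∈ with ∈-++⁻ (explored s y) (subst (x ∈_) (explored-moved y) x∈)
    ... | inj₁ x∈old = mono x (backVisited y x x∈old)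
    ... | inj₂ x∈new = subst (λ z → visited′ z ≡ true) (sym (∈-new x∈new)) vis-v
      where
      ∈-new : ∀ {b} → x ∈ (if b then [ v ] else []) → x ≡ v
      ∈-new {true} (here x≡v) = x≡v

    unvisited-moved : ∀ w → visited s w ≡ false → next moved w ≡ 0
    unvisited-moved w unvis =
      trans (update-≢ (next s) _ (≢-sym (distinct curVisited unvis))) (proj₁ (unvisitedFresh w unvis))

    schedule-moved : ∀ w → Schedule (out G w) (B s w) (skipped s w) (position moved w) (written s w)
    schedule-moved w =
      subst (λ k → Schedule (out G w) (B s w) (skipped s w) k (written s w)) (sym (position-moved w)) (schedule w)

    revisit : visited s v ≡ true → Invariant moved
    revisit vis-v = record
      { tip = tip ; rank = rank ; rankBound = rankBound ; c≡length = c≡length ; trail = trail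
      ; backBalance = backBalance-moved ; curVisited = vis-v ; v₀Visited = v₀Visited
      ; backVisited = backVisited-moved (visited s) (λ _ vis → vis) vis-v
      ; parent = parent ; rank<bound = rank<bound
      ; unvisitedFresh = λ w unvis → unvisited-moved w unvis , proj₂ (unvisitedFresh w unvis)
      ; schedule = schedule-moved }

    module Discover (fresh : visited s v ≡ false) where
      visited′ : Fin n → Bool
      visited′ = update (visited s) v true

      B′ : Fin n → Maybe (Fin n)
      B′ = update (B s) v (just u)

      rank′ : Fin n → ℕ
      rank′ = update rank v rankBound

      old≢v : ∀ {w} → visited s w ≡ true → w ≢ v
      old≢v vis = distinct vis fresh

      visited-mono : ∀ w → visited s w ≡ true → visited′ w ≡ true
      visited-mono w vis = trans (update-≢ (visited s) true (old≢v vis)) vis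

      visited′-v : visited′ v ≡ true
      visited′-v = update-≡ (visited s) v true

      parent′ : ∀ w → visited′ w ≡ true → w ≢ v₀ →
                ∃[ p ] B′ w ≡ just p × visited′ p ≡ true × rank′ p < rank′ w × p ∈ out G w
      parent′ w vis w≢v₀ with w ≟ v
      ... | yes refl = u , refl , visited-mono u curVisited ,
                       subst (_< rankBound) (sym (update-≢ rank rankBound (old≢v curVisited))) (rank<bound u curVisited) ,
                       inn⇒out v∈
      ... | no  w≢v with parent w vis w≢v₀
      ...   | p , B≡p , vis-p , rank< , p∈ =
                p , B≡p , visited-mono p vis-p , subst (_< rank w) (sym (update-≢ rank rankBound (old≢v vis-p))) rank< ,
                p∈

      rank′<bound : ∀ w → visited′ w ≡ true → rank′ w < suc rankBound
      rank′<bound w vis with w ≟ v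
      ... | yes refl = n<1+n rankBound
      ... | no  _    = m≤n⇒m≤1+n (rank<bound w vis)

      unvisitedFresh′ : ∀ w → visited′ w ≡ false → next moved w ≡ 0 × skipped s w ≡ false
      unvisitedFresh′ w unvis with w ≟ v
      ... | yes refl = ⊥-elim (true≢false unvis)
      ... | no  _    = unvisited-moved w unvis , proj₂ (unvisitedFresh w unvis)

      skipped-v : skipped s v ≡ false
      skipped-v = proj₂ (unvisitedFresh v fresh)

      position-v : position s v ≡ 0
      position-v = trans (cong (_∸ indeg G v) (proj₁ (unvisitedFresh v fresh))) (0∸n≡0 (indeg G v))

      written-v : written s v ≡ []
      written-v = schedule-unstarted
        (subst₂ (λ sk k → Schedule (out G v) (B s v) sk k (written s v)) skipped-v position-v (schedule v))

      schedule′ : ∀ w → Schedule (out G w) (B′ w) (skipped s w) (position moved w) (written s w)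
      schedule′ w with w ≟ v
      ... | no  _    = schedule-moved w
      ... | yes refl rewrite unvisited-moved v fresh | 0∸n≡0 (indeg G v) | skipped-v | written-v = schedule-start

      invariant : Invariant (record moved { visited = visited′ ; B = B′ })
      invariant = record
        { tip = tip ; rank = rank′ ; rankBound = suc rankBound ; c≡length = c≡length ; trail = trail
        ; backBalance = backBalance-moved ; curVisited = visited′-v
        ; v₀Visited = visited-mono v₀ v₀Visited
        ; backVisited = backVisited-moved visited′ visited-mono visited′-v
        ; parent = parent′ ; rank<bound = rank′<bound
        ; unvisitedFresh = unvisitedFresh′ ; schedule = schedule′ }

    invariant : Invariant (backState s v)
    invariant with visited s v in vis
    ... | true  = revisit vis
    ... | false rewrite dec-false (v ≟ v₀) (≢-sym (distinct v₀Visited vis)) = Discover.invariant vis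

    ∑backFrom-moved : ∑ (backFrom moved) ≡ suc (∑ (backFrom s))
    ∑backFrom-moved = begin
      ∑ (backFrom moved)                         ≡⟨ sum-cong-≗ backFrom-moved ⟩
      ∑ (λ w → backFrom s w + δ w u)             ≡⟨ ∑-distrib-+ (backFrom s) (λ w → δ w u) ⟩
      ∑ (backFrom s) + ∑ (λ w → δ w u)           ≡⟨ cong (∑ (backFrom s) +_) (∑-indicator u 1) ⟩
      ∑ (backFrom s) + 1                         ≡⟨ +-comm _ 1 ⟩
      suc (∑ (backFrom s))                       ∎
      where open ≡-Reasoning

    ∑backFrom<m : ∑ (backFrom s) < m
    ∑backFrom<m = begin-strict
      ∑ (backFrom s)  <⟨ ∑-mono-< (λ w → m⊓n≤n (next s w) (indeg G w)) u (subst (_< indeg G u) (sym backFrom-u) room) ⟩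
      ∑ (indeg G)     ≡⟨ sum-cong-≗ outdeg≡indeg ⟨
      ∑ (outdeg G)    ≡⟨ m≡∑outdeg ⟨
      m               ∎
      where open ≤-Reasoning

    progress : Progress s
    progress = backState s v , hstep-back s room nth≡v , invariant , μ↓
      where
      μ↓ : μ (backState s v) < μ s
      μ↓ rewrite ∑backFrom-moved = +-monoʳ-< (m ∸ c s) (∸-monoʳ-< (n<1+n _) ∑backFrom<m)

  module Forward (s : State n) (inv : Invariant s) (stalled : indeg G (cur s) ≤ next s (cur s))
                 (unfinished : writtenFrom s (cur s) < outdeg G (cur s)) where
    open Invariant inv

    u : Fin n
    u = cur s

    cur≡tip : u ≡ tip
    cur≡tip = stalled⇒cur≡tip inv stalled

    skip : Bool
    skip = skipHere s

    i≡ : suc (next s u) ∸ indeg G u ≡ suc (position s u)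
    i≡ = +-∸-assoc 1 stalled

    write : NextWrite (out G u) (B s u) (skipped s u) (written s u) (suc (next s u) ∸ indeg G u) skip
    write = subst (λ i → NextWrite (out G u) (B s u) (skipped s u) (written s u) i
                                   (skipNow (out G u) (B s u) (skipped s u) i))
                  (sym i≡) (schedule-step (schedule u) unfinished)

    v : Fin n
    v = NextWrite.head write

    s′ : State n
    s′ = forwardState s v

    next′-other : ∀ {w} → w ≢ u → next s′ w ≡ next s w
    next′-other = update-≢ (next s) _

    skipped′-u : skipped s′ u ≡ skip ∨ skipped s u
    skipped′-u with skip
    ... | true  = update-≡ (skipped s) u true
    ... | false = refl

    skipped′-other : ∀ {w} → w ≢ u → skipped s′ w ≡ skipped s w
    skipped′-other w≢u with skip
    ... | true  = update-≢ (skipped s) true w≢u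
    ... | false = refl

    next≤advance : next s u ≤ advance skip (suc (next s u))
    next≤advance with skip
    ... | true  = m≤n+m (next s u) 2
    ... | false = n≤1+n (next s u)

    backFrom′ : ∀ w → backFrom s′ w ≡ backFrom s w
    backFrom′ w with w ≟ u
    ... | yes refl = trans (m≥n⇒m⊓n≡n (≤-trans stalled next≤advance)) (sym (m≥n⇒m⊓n≡n stalled))
    ... | no  _    = refl

    position′-u : position s′ u ≡ advance skip (suc (next s u) ∸ indeg G u)
    position′-u with skip
    ... | true  = trans (cong (_∸ indeg G u) (update-≡ (next s) u _)) (+-∸-assoc 1 (m≤n⇒m≤1+n stalled))
    ... | false = cong (_∸ indeg G u) (update-≡ (next s) u _)

    written′ : ∀ w → written s′ w ≡ written s w ++ (if does (w ≟ u) then [ v ] else [])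
    written′ w = headsFrom-snoc w (output s) u v

    schedule′ : ∀ w → Schedule (out G w) (B s w) (skipped s′ w) (position s′ w) (written s′ w)
    schedule′ w = by-vertex (w ≟ u)
      where
      by-vertex : Dec (w ≡ u) → Schedule (out G w) (B s w) (skipped s′ w) (position s′ w) (written s′ w)
      by-vertex (yes refl)
        rewrite skipped′-u | position′-u | written′ u | if-≟-≡ {a = [ v ]} {b = []} (refl {x = u})
        = NextWrite.schedule write
      by-vertex (no w≢u)
        rewrite skipped′-other w≢u | next′-other w≢u | written′ w | if-≟-≢ {a = [ v ]} {b = []} w≢u
              | ++-identityʳ (written s w)
        = schedule w

    invariant : Invariant s′
    invariant = record
      { tip = v ; rank = rank ; rankBound = rankBound
      ; c≡length = trans (cong suc c≡length) (sym (length-snoc (output s) (u , v)))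
      ; trail = subst (λ t → Trail v₀ (output s ++ [ (t , v) ]) v) (sym cur≡tip) (trail ▷ v)
      ; backBalance = λ w → cong (_+ δ w v) (begin
          backInto s′ w ≡⟨ sum-cong-≗ (λ y → cong (λ k → countV w (take k (inn G y))) (backFrom′ y)) ⟩
          backInto s w  ≡⟨ AtTip.backInto≡backFrom inv cur≡tip w ⟩
          backFrom s w  ≡⟨ backFrom′ w ⟨
          backFrom s′ w ∎)
      ; curVisited = AtTip.out-visited inv cur≡tip stalled (NextWrite.head∈ write)
      ; v₀Visited = v₀Visited
      ; backVisited = λ y x x∈ → backVisited y x (subst (λ k → x ∈ take k (inn G y)) (backFrom′ y) x∈)
      ; parent = parent ; rank<bound = rank<bound
      ; unvisitedFresh = λ w unvis → let w≢u = ≢-sym (distinct curVisited unvis) in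
          trans (next′-other w≢u) (proj₁ (unvisitedFresh w unvis)) ,
          trans (skipped′-other w≢u) (proj₂ (unvisitedFresh w unvis))
      ; schedule = schedule′ }
      where open ≡-Reasoning

    progress : c s < m → Progress s
    progress c<m = s′ , hstep-forward s (≤⇒≯ stalled) (NextWrite.read write) , invariant , μ↓
      where
      μ↓ : μ s′ < μ s
      μ↓ rewrite sum-cong-≗ backFrom′ = +-monoˡ-< (m ∸ ∑ (backFrom s)) (∸-monoʳ-< (n<1+n (c s)) c<m)

  progress : ∀ s → Invariant s → c s < m → Progress s
  progress s inv c<m = by-room (suc (next s (cur s)) ≤? indeg G (cur s))
    where
    by-room : Dec (suc (next s (cur s)) ≤ indeg G (cur s)) → Progress s
    by-room (yes room) =
      let v , nth≡v , take≡ , v∈ = nth-take (next s (cur s)) (inn G (cur s)) room in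
      Back.progress s inv room nth≡v take≡ v∈
    by-room (no no-room) = Forward.progress s inv stalled (stalled-unfinished inv stalled c<m) c<m
      where
      stalled : indeg G (cur s) ≤ next s (cur s)
      stalled = ≤-pred (≰⇒> no-room)

  module _ {s : State n} (inv : Invariant s) (m≤c : m ≤ c s) where
    open Invariant inv

    c≡m : c s ≡ m
    c≡m = ≤-antisym (subst₂ _≤_ (∑writtenFrom≡c inv) (sym m≡∑outdeg) (∑-mono-≤ (writtenFrom≤outdeg inv))) m≤c

    all-written : ∀ u → writtenFrom s u ≡ outdeg G u
    all-written = ∑-≤-≡⇒≡ (writtenFrom≤outdeg inv) (trans (∑writtenFrom≡c inv) (trans c≡m m≡∑outdeg))

    writtenInto-v₀ : writtenInto s v₀ ≡ writtenFrom s v₀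
    writtenInto-v₀ = begin
      writtenInto s v₀               ≡⟨ sum-cong-≗ (λ x → schedule-complete (schedule x) (all-written x) v₀) ⟩
      ∑ (λ x → countV v₀ (out G x))  ≡⟨ indeg≡∑countV v₀ ⟩
      indeg G v₀                     ≡⟨ outdeg≡indeg v₀ ⟨
      outdeg G v₀                    ≡⟨ all-written v₀ ⟨
      writtenFrom s v₀               ∎
      where open ≡-Reasoning

    tip≡v₀ : tip ≡ v₀
    tip≡v₀ = sym (δ≡1⇒≡ (+-cancelˡ-≡ (writtenFrom s v₀) _ _ (begin
      writtenFrom s v₀ + δ v₀ tip  ≡⟨ writeBalance inv v₀ ⟨
      writtenInto s v₀ + δ v₀ v₀   ≡⟨ cong₂ _+_ writtenInto-v₀ (δ-refl v₀) ⟩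
      writtenFrom s v₀ + 1         ∎)))
      where open ≡-Reasoning

    complete⇒eulerian : 1 ≤ m → IsEulerianCycle G (output s)
    complete⇒eulerian m≥1 with trail-consecutive trail
    ... | inj₁ output≡[] = ⊥-elim (<-irrefl (sym (trans (sym c≡m) (trans c≡length (cong length output≡[])))) m≥1)
    ... | inj₂ (mid , output≡) =
      v₀ ∷ mid ++ [ v₀ ] , v₀ , mid , refl ,
      subst (λ t → output s ≡ consecutive (v₀ ∷ mid ++ [ t ])) tip≡v₀ output≡ ,
      λ x y → trans (countE≡countV-headsFrom x y (output s)) (schedule-complete (schedule x) (all-written x) y)

  run-eulerian : ∀ fuel s → Invariant s → μ s < fuel → 1 ≤ m →
                 ∃[ es ] run G v₀ fuel s ≡ just es × IsEulerianCycle G es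
  run-eulerian (suc fuel) s inv μ<fuel m≥1 with edgeCount G ≤? c s
  ... | yes m≤c = output s , refl , complete⇒eulerian inv m≤c m≥1
  ... | no  m≰c with progress s inv (≰⇒> m≰c)
  ...   | s′ , hstep≡ , inv′ , μ↓ rewrite hstep≡ =
    run-eulerian fuel s′ inv′ (<-≤-trans μ↓ (≤-pred μ<fuel)) m≥1

  initial : Invariant (initState v₀)
  initial = record
    { tip = v₀ ; rank = λ _ → 0 ; rankBound = 1 ; c≡length = refl ; trail = []
    ; backBalance = λ w → cong (_+ δ w v₀) (sum-replicate-zero n)
    ; curVisited = update-≡ (λ _ → false) v₀ true
    ; v₀Visited = update-≡ (λ _ → false) v₀ true
    ; backVisited = λ _ _ ()
    ; parent = λ w vis w≢v₀ → ⊥-elim (true≢false (trans (sym vis) (update-≢ (λ _ → false) true w≢v₀)))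
    ; rank<bound = λ _ _ → s≤s z≤n
    ; unvisitedFresh = λ _ _ → refl , refl
    ; schedule = λ u → subst (λ k → Schedule (out G u) nothing false k []) (sym (0∸n≡0 (indeg G u))) schedule-start }

theorem11 : ∀ (n : ℕ) (G : Digraph n) → Consistent G → Eulerian G → 1 ≤ edgeCount G
    → (v₀ : Fin n)
    → ∃[ fuel ] ∃[ es ] (run G v₀ fuel (initState v₀) ≡ just es) × IsEulerianCycle G es
theorem11 n G consistent eulerian m≥1 v₀ =
  suc (μ (initState v₀)) , run-eulerian (suc (μ (initState v₀))) (initState v₀) initial ≤-refl m≥1
  where open Hierholzer G v₀ consistent eulerian
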